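{- Let $n\in\mathbb{N}$, $n\ge1$. The sensitivity of $BPM_n$ satisfies \[\mathrm{s}(BPM_n)\ge\begin{cases}\frac n2\left(\frac n2+1\right), & n\equiv 0\pmod 2,\\[2pt] \left(\frac{n-1}{2}+1\right)^2, & n\equiv1\pmod 2.\end{cases}\]
   Context: $BPM_n:\{0,1\}^{n^2}\to\{0,1\}$ outputs 1 iff the bipartite graph $\{(a_i,b_j):x_{i,j}=1\}\subseteq K_{n,n}$ has a perfect matching. For a Boolean function $f$ on $\{0,1\}^N$ and $x\in\{0,1\}^N$, $\mathrm{s}_x(f)$ is the number of coordinates $i$ such that flipping the $i$-th bit of $x$ changes the value of $f$, and the sensitivity is $\mathrm{s}(f)=\max_x \mathrm{s}_x(f)$. -}

module Defs where

open import Data.Nat using (ℕ; _+_; _*_; _∸_; _^_; _/_; _%_; _≤_)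
open import Data.Bool using (Bool; true; false; not)
open import Data.Fin using (Fin; _≟_)
open import Data.Fin.Permutation using (Permutation′; _⟨$⟩ʳ_)
open import Data.Product using (Σ; ∃; _×_; _,_)
open import Data.Sum using (_⊎_)
open import Relation.Nullary using (¬_; yes; no)
open import Relation.Binary.PropositionalEquality using (_≡_)
open import Function.Definitions using (Injective)

-- An input of BPM_n: x i j = x_{i,j}, i.e. edge (a_i , b_j) present iff true.
Input : ℕ → Set
Input n = Fin n → Fin n → Bool

-- BPM_n(x) = 1 iff the bipartite graph has a perfect matching,
-- i.e. a bijection σ : Fin n → Fin n with every edge (a_i, b_{σ i}) present.
BPM : (n : ℕ) → Input n → Set
BPM n x = Σ (Permutation′ n) λ σ → ∀ i → x i (σ ⟨$⟩ʳ i) ≡ true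

flipAt : ∀ {n} → Input n → Fin n → Fin n → Input n
flipAt x i j k l with i ≟ k | j ≟ l
... | yes _ | yes _ = not (x k l)
... | _     | _     = x k l

Sensitive : ∀ n → Input n → Fin n × Fin n → Set
Sensitive n x (i , j) =
  (BPM n x × ¬ BPM n (flipAt x i j)) ⊎ (¬ BPM n x × BPM n (flipAt x i j))

SensitivityAtLeast : ℕ → ℕ → Set
SensitivityAtLeast n k =
  Σ (Input n) λ x → Σ (Fin k → Fin n × Fin n) λ c →
    Injective _≡_ _≡_ c × (∀ t → Sensitive n x (c t))

bound : ℕ → ℕ
bound n with n % 2
... | 0 = (n / 2) * (n / 2 + 1)
... | _ = ((n ∸ 1) / 2 + 1) ^ 2

-- The input is the disjoint union of two complete bipartite blocks: the upper m+1 rows are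
-- joined to the left m columns and the lower e rows to the right e+1 columns.  The upper
-- rows violate Hall's condition, so there is no perfect matching; yet adding any missing
-- edge (α, δ) from an upper row to a right column creates one (α matched to δ, the corner
-- row m to α, row δ to column m, the rest on the diagonal).  This gives (m+1)(e+1)
-- sensitive coordinates; for m + 1 + e = n take m = ⌈n/2⌉ - 1 and e = ⌊n/2⌋.
module Submission where

open import Defs
open import Data.Nat using (ℕ; zero; suc; _+_; _*_; _≤_; _<_; _≤?_; _<?_; z<s)
open import Data.Nat.Properties using (<-cmp; <⇒≢; <⇒≱; <⇒≤; ≤-pred; ≤-refl; ≤-reflexive; ≤∧≢⇒<; <-≤-trans; m<m+n; m≤m+n; +-comm; *-identityʳ)
open import Data.Nat.DivMod using (m*n%n≡0; m*n/n≡m; [m+kn]%n≡m%n)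
open import Data.Nat.Tactic.RingSolver using (solve-∀)
open import Data.Bool using (true; false; not)
open import Data.Fin using (Fin; toℕ; fromℕ<; inject≤; _↑ʳ_; remQuot)
open import Data.Fin.Properties using (_≟_; toℕ-injective; toℕ-fromℕ<; toℕ-inject≤; fromℕ<-injective; inject≤-injective; ↑ʳ-injective; toℕ-↑ʳ; pigeonhole; *↔×; toℕ<n)
open import Data.Fin.Permutation as Perm using (Permutation′; _⟨$⟩ʳ_; _∘ₚ_)
import Data.Fin.Permutation.Components as PC
open import Data.Product using (∃; _×_; _,_; map)
open import Data.Product.Properties using (,-injectiveˡ; ,-injectiveʳ)
open import Data.Sum using (_⊎_; inj₁; inj₂)
open import Relation.Nullary using (¬_; yes; no; contradiction)
open import Relation.Nullary.Decidable using (dec-true)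
open import Relation.Binary.PropositionalEquality
open import Relation.Binary.Definitions using (tri<; tri≈; tri>)
open import Function using (_∘_)
open import Function.Bundles using (Injection)
open import Function.Definitions using (Injective)
open import Function.Properties.Inverse using (↔⇒↣)

flipAt-same : ∀ {n} (x : Input n) i j → flipAt x i j i j ≡ not (x i j)
flipAt-same x i j with i ≟ i | j ≟ j
... | yes _  | yes _  = refl
... | no i≢i | _      = contradiction refl i≢i
... | yes _  | no j≢j = contradiction refl j≢j

flipAt-other-row : ∀ {n} (x : Input n) {i k} j l → i ≢ k → flipAt x i j k l ≡ x k l
flipAt-other-row x {i} {k} j l i≢k with i ≟ k | j ≟ l
... | yes i≡k | yes _ = contradiction i≡k i≢k
... | yes _   | no _  = refl
... | no _    | yes _ = refl
... | no _    | no _  = refl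

transpose-left : ∀ {n} (i j : Fin n) → PC.transpose i j i ≡ j
transpose-left i j rewrite dec-true (i ≟ i) refl = refl

transpose-right : ∀ {n} (i j : Fin n) → PC.transpose i j j ≡ i
transpose-right i j with j ≟ i
... | yes j≡i = j≡i
... | no _ rewrite dec-true (j ≟ j) refl = refl

transpose-other : ∀ {n} {i j k : Fin n} → k ≢ i → k ≢ j → PC.transpose i j k ≡ k
transpose-other {i = i} {j} {k} k≢i k≢j with k ≟ i
... | yes k≡i = contradiction k≡i k≢i
... | no _ with k ≟ j
...   | yes k≡j = contradiction k≡j k≢j
...   | no _    = refl

cycle₃ : ∀ {n} → Fin n → Fin n → Fin n → Permutation′ n
cycle₃ a b c = Perm.transpose a c ∘ₚ Perm.transpose c b

cycle₃-first : ∀ {n} (a b c : Fin n) → cycle₃ a b c ⟨$⟩ʳ a ≡ b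
cycle₃-first a b c = trans (cong (PC.transpose c b) (transpose-left a c)) (transpose-left c b)

cycle₃-second : ∀ {n} {a b c : Fin n} → b ≢ a → b ≢ c → cycle₃ a b c ⟨$⟩ʳ b ≡ c
cycle₃-second {b = b} {c} b≢a b≢c =
  trans (cong (PC.transpose c b) (transpose-other b≢a b≢c)) (transpose-right c b)

cycle₃-third : ∀ {n} {a b c : Fin n} → a ≢ c → a ≢ b → cycle₃ a b c ⟨$⟩ʳ c ≡ a
cycle₃-third {a = a} {b} {c} a≢c a≢b =
  trans (cong (PC.transpose c b) (transpose-right a c)) (transpose-other a≢c a≢b)

cycle₃-fixed : ∀ {n} {a b c k : Fin n} → k ≢ a → k ≢ b → k ≢ c → cycle₃ a b c ⟨$⟩ʳ k ≡ k
cycle₃-fixed {b = b} {c} k≢a k≢b k≢c =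
  trans (cong (PC.transpose c b) (transpose-other k≢a k≢c)) (transpose-other k≢c k≢b)

crowded-rows⇒¬BPM : ∀ {n s k} (x : Input n) → k < s → s ≤ n →
  (∀ i j → toℕ i < s → x i j ≡ true → toℕ j < k) → ¬ BPM n x
crowded-rows⇒¬BPM {s = s} {k} x k<s s≤n confined (σ , matched) =
  let p , q , p<q , same-code = pigeonhole k<s code
  in <⇒≢ p<q (cong toℕ (inject≤-injective s≤n s≤n p q (σ-injective (toℕ-injective
       (fromℕ<-injective _ _ (column<k p) (column<k q) same-code)))))
  where
  row : Fin s → Fin _
  row p = inject≤ p s≤n
  σ-injective : Injective _≡_ _≡_ (σ ⟨$⟩ʳ_)
  σ-injective = Injection.injective (↔⇒↣ σ)
  column<k : ∀ p → toℕ (σ ⟨$⟩ʳ row p) < k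
  column<k p = confined (row p) _ (subst (_< s) (sym (toℕ-inject≤ p s≤n)) (toℕ<n p)) (matched (row p))
  code : Fin s → Fin k
  code p = fromℕ< (column<k p)

flipAt-completes-matching : ∀ {n} (x : Input n) (σ : Permutation′ n) {α δ} →
  σ ⟨$⟩ʳ α ≡ δ → x α δ ≡ false → (∀ i → i ≢ α → x i (σ ⟨$⟩ʳ i) ≡ true) →
  BPM n (flipAt x α δ)
flipAt-completes-matching x σ {α} {δ} refl missing matched = σ , edge
  where
  edge : ∀ i → flipAt x α δ i (σ ⟨$⟩ʳ i) ≡ true
  edge i with i ≟ α
  ... | yes refl = trans (flipAt-same x α δ) (cong not missing)
  ... | no i≢α   = trans (flipAt-other-row x δ _ (i≢α ∘ sym)) (matched i i≢α)

sensitive-box⇒SensitivityAtLeast : ∀ {n a b} (x : Input n) (row : Fin a → Fin n) (col : Fin b → Fin n) →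
  Injective _≡_ _≡_ row → Injective _≡_ _≡_ col →
  (∀ p q → Sensitive n x (row p , col q)) → SensitivityAtLeast n (a * b)
sensitive-box⇒SensitivityAtLeast {b = b} x row col row-injective col-injective sensitive =
  x , coordinate , coordinate-injective , λ t → sensitive _ _
  where
  coordinate : Fin _ → Fin _ × Fin _
  coordinate = map row col ∘ remQuot b
  coordinate-injective : Injective _≡_ _≡_ coordinate
  coordinate-injective eq = Injection.injective (↔⇒↣ *↔×)
    (cong₂ _,_ (row-injective (,-injectiveˡ eq)) (col-injective (,-injectiveʳ eq)))

module TwoBlocks (m e : ℕ) where

  N : ℕ
  N = m + suc e

  m<N : m < N
  m<N = m<m+n m z<s

  twoBlocks : Input N
  twoBlocks i j with toℕ i ≤? m | toℕ j <? m
  ... | yes _ | yes _ = true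
  ... | no _  | no _  = true
  ... | _     | _     = false

  twoBlocks-upper-left : ∀ {i j} → toℕ i ≤ m → toℕ j < m → twoBlocks i j ≡ true
  twoBlocks-upper-left {i} {j} i≤m j<m with toℕ i ≤? m | toℕ j <? m
  ... | yes _  | yes _  = refl
  ... | no i≰m | _      = contradiction i≤m i≰m
  ... | yes _  | no j≮m = contradiction j<m j≮m

  twoBlocks-lower-right : ∀ {i j} → m < toℕ i → m ≤ toℕ j → twoBlocks i j ≡ true
  twoBlocks-lower-right {i} {j} m<i m≤j with toℕ i ≤? m | toℕ j <? m
  ... | yes i≤m | _       = contradiction i≤m (<⇒≱ m<i)
  ... | no _    | yes j<m = contradiction m≤j (<⇒≱ j<m)
  ... | no _    | no _    = refl

  twoBlocks-upper⇒left : ∀ {i j} → toℕ i ≤ m → twoBlocks i j ≡ true → toℕ j < m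
  twoBlocks-upper⇒left {i} {j} i≤m _ with toℕ i ≤? m | toℕ j <? m
  ... | _      | yes j<m = j<m
  ... | no i≰m | no _    = contradiction i≤m i≰m
  twoBlocks-upper⇒left i≤m () | yes _ | no _

  twoBlocks-¬BPM : ¬ BPM N twoBlocks
  twoBlocks-¬BPM = crowded-rows⇒¬BPM twoBlocks ≤-refl m<N
    (λ i j i<1+m → twoBlocks-upper⇒left (≤-pred i<1+m))

  corner : Fin N
  corner = fromℕ< m<N

  toℕ-corner : toℕ corner ≡ m
  toℕ-corner = toℕ-fromℕ< m<N

  toℕ≡m⇒≡corner : ∀ {i} → toℕ i ≡ m → i ≡ corner
  toℕ≡m⇒≡corner i≡m = toℕ-injective (trans i≡m (sym toℕ-corner))

  toℕ≢m⇒≢corner : ∀ {i} → toℕ i ≢ m → i ≢ corner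
  toℕ≢m⇒≢corner i≢m i≡corner = i≢m (trans (cong toℕ i≡corner) toℕ-corner)

  toℕ<⇒≢ : ∀ {i j : Fin N} → toℕ i < toℕ j → i ≢ j
  toℕ<⇒≢ i<j = <⇒≢ i<j ∘ cong toℕ

  twoBlocks-flip-BPM : ∀ {α δ} → toℕ α ≤ m → m ≤ toℕ δ → BPM N (flipAt twoBlocks α δ)
  twoBlocks-flip-BPM {α} {δ} α≤m m≤δ =
    flipAt-completes-matching twoBlocks σ (cycle₃-first α δ corner) missing matched
    where
    σ : Permutation′ N
    σ = cycle₃ α δ corner

    missing : twoBlocks α δ ≡ false
    missing with twoBlocks α δ in edge
    ... | false = refl
    ... | true  = contradiction m≤δ (<⇒≱ (twoBlocks-upper⇒left α≤m edge))

    matched : ∀ i → i ≢ α → twoBlocks i (σ ⟨$⟩ʳ i) ≡ true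
    matched i i≢α with <-cmp (toℕ i) m
    ... | tri< i<m i≢m _ =
      trans (cong (twoBlocks i) (cycle₃-fixed i≢α (toℕ<⇒≢ (<-≤-trans i<m m≤δ)) (toℕ≢m⇒≢corner i≢m)))
            (twoBlocks-upper-left (<⇒≤ i<m) i<m)
    ... | tri≈ _ i≡m _ =
      trans (cong (twoBlocks i) (trans (cong (σ ⟨$⟩ʳ_) (toℕ≡m⇒≡corner i≡m)) (cycle₃-third α≢corner α≢δ)))
            (twoBlocks-upper-left (≤-reflexive i≡m) α<m)
      where
      α≢corner : α ≢ corner
      α≢corner α≡corner = i≢α (trans (toℕ≡m⇒≡corner i≡m) (sym α≡corner))
      α<m : toℕ α < m
      α<m = ≤∧≢⇒< α≤m (α≢corner ∘ toℕ≡m⇒≡corner)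
      α≢δ : α ≢ δ
      α≢δ = toℕ<⇒≢ (<-≤-trans α<m m≤δ)
    ... | tri> _ i≢m m<i with i ≟ δ
    ...   | yes refl =
      trans (cong (twoBlocks i) (cycle₃-second i≢α (toℕ≢m⇒≢corner i≢m)))
            (twoBlocks-lower-right m<i (≤-reflexive (sym toℕ-corner)))
    ...   | no i≢δ =
      trans (cong (twoBlocks i) (cycle₃-fixed i≢α i≢δ (toℕ≢m⇒≢corner i≢m)))
            (twoBlocks-lower-right m<i (<⇒≤ m<i))

  twoBlocks-sensitivity : SensitivityAtLeast N (suc m * suc e)
  twoBlocks-sensitivity =
    sensitive-box⇒SensitivityAtLeast twoBlocks upper right
      (inject≤-injective m<N m<N _ _) (↑ʳ-injective m _ _)
      (λ p q → inj₂ (twoBlocks-¬BPM , twoBlocks-flip-BPM (upper≤m p) (m≤right q)))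
    where
    upper : Fin (suc m) → Fin N
    upper p = inject≤ p m<N
    right : Fin (suc e) → Fin N
    right q = m ↑ʳ q
    upper≤m : ∀ p → toℕ (upper p) ≤ m
    upper≤m p = subst (_≤ m) (sym (toℕ-inject≤ p m<N)) (≤-pred (toℕ<n p))
    m≤right : ∀ q → m ≤ toℕ (right q)
    m≤right q = subst (m ≤_) (sym (toℕ-↑ʳ m q)) (m≤m+n m (toℕ q))

even-or-odd : ∀ n → ∃ λ k → n ≡ k * 2 ⊎ n ≡ 1 + k * 2
even-or-odd zero = 0 , inj₁ refl
even-or-odd (suc n) with even-or-odd n
... | k , inj₁ refl = k , inj₂ refl
... | k , inj₂ refl = suc k , inj₁ refl

bound-even : ∀ k → bound (suc k * 2) ≡ suc k * suc (suc k)
bound-even k rewrite m*n%n≡0 (suc k) 2 ⦃ _ ⦄ | m*n/n≡m (suc k) 2 ⦃ _ ⦄ = cong (suc k *_) (+-comm (suc k) 1)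

bound-odd : ∀ k → bound (1 + k * 2) ≡ suc k * suc k
bound-odd k rewrite [m+kn]%n≡m%n 1 k 2 ⦃ _ ⦄ | m*n/n≡m k 2 ⦃ _ ⦄ | +-comm k 1 | *-identityʳ k = refl

blocks≡even : ∀ k → k + suc (suc k) ≡ suc k * 2
blocks≡even = solve-∀

blocks≡odd : ∀ k → k + suc k ≡ 1 + k * 2
blocks≡odd = solve-∀

theorem4p9 : (n : ℕ) → 1 ≤ n → SensitivityAtLeast n (bound n)
theorem4p9 n 1≤n with even-or-odd n
... | zero , inj₁ refl = contradiction 1≤n λ ()
... | suc k , inj₁ refl = subst₂ SensitivityAtLeast (blocks≡even k) (sym (bound-even k))
                            (TwoBlocks.twoBlocks-sensitivity k (suc k))
... | k , inj₂ refl = subst₂ SensitivityAtLeast (blocks≡odd k) (sym (bound-odd k))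
                        (TwoBlocks.twoBlocks-sensitivity k k)
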